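{- Let $(X,R)$ be a forcing network and let $T$ be an $X$-colored tree. Then, in the multi-color forcing process with propagation applied to $T$, each propagating forcing step completes in at most $\operatorname{diam}(T)$ forcing steps (counting only forcing steps in which at least one vertex changes color), where $\operatorname{diam}(T)$ is the maximum distance between two vertices of $T$.
   Context: Let $X\subseteq\{1,\dots,N\}$ be a finite set of colors. An $X$-colored graph is a finite simple graph together with an assignment of a color from $X$ to each vertex. A forcing network is a pair $(X,R)$ where $R=(r_1,\dots,r_m)$ is an ordered list of color change rules, each of the form $a\to b$ with $a,b\in X$, $a\neq b$. A forcing step with rule $a\to b$ means: simultaneously recolor with color $a$ every vertex of color $b$ that has at least one neighbor of color $a$. A propagating forcing step with rule $a\to b$ means performing forcing steps with this rule repeatedly until no vertex of color $b$ has a neighbor of color $a$. In the multi-color forcing process with propagation, the rules are applied as propagating forcing steps in the cyclic order $r_1,\dots,r_m,r_1,\dots$, until no rule $a\to b\in R$ has an edge joining a vertex of color $a$ and a vertex of color $b$. -}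

module Defs where

open import Data.Nat using (ℕ; zero; suc; _≤_; _<_; _≡ᵇ_)
open import Data.Fin using (Fin)
open import Data.Bool using (Bool; true; false; if_then_else_; _∧_)
open import Data.List using (List; []; _∷_; allFin; length)
open import Data.Bool.ListAction using (any)
open import Data.List.Membership.Propositional using (_∈_)
open import Data.List.Relation.Unary.All using (All)
open import Data.List.Relation.Unary.Unique.Propositional using (Unique)
open import Data.Product using (Σ; _×_; _,_; ∃; ∃-syntax)
open import Relation.Binary.PropositionalEquality using (_≡_; _≢_)
open import Relation.Nullary using (¬_)
open import Function using (_∘_)

record Graph : Set where
  field
    n     : ℕ
    adj   : Fin n → Fin n → Bool
    sym   : ∀ u v → adj u v ≡ adj v u
    irrefl : ∀ v → adj v v ≡ false
open Graph public

data Walk (G : Graph) : Fin (n G) → Fin (n G) → ℕ → Set where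
  here : ∀ v → Walk G v v 0
  cons : ∀ {u v w k} → adj G u v ≡ true → Walk G v w k → Walk G u w (suc k)

Connected : Graph → Set
Connected G = ∀ u v → ∃[ k ] Walk G u v k

data Chain (G : Graph) : List (Fin (n G)) → Set where
  nil  : Chain G []
  one  : ∀ v → Chain G (v ∷ [])
  cons : ∀ {u v vs} → adj G u v ≡ true → Chain G (v ∷ vs) → Chain G (u ∷ v ∷ vs)

HasCycle : Graph → Set
HasCycle G = ∃[ v₀ ] ∃[ vs ] ∃[ vₖ ]
  (3 ≤ length (v₀ ∷ vs Data.List.++ (vₖ ∷ [])) ×
   Unique (v₀ ∷ vs Data.List.++ (vₖ ∷ [])) ×
   Chain G (v₀ ∷ vs Data.List.++ (vₖ ∷ [])) ×
   adj G vₖ v₀ ≡ true)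

IsTree : Graph → Set
IsTree G = Connected G × ¬ HasCycle G

Dist : (G : Graph) → Fin (n G) → Fin (n G) → ℕ → Set
Dist G u v d = Walk G u v d × (∀ k → Walk G u v k → d ≤ k)

IsDiam : Graph → ℕ → Set
IsDiam G D = (∃[ u ] ∃[ v ] Dist G u v D) ×
             (∀ u v d → Dist G u v d → d ≤ D)

record Rule : Set where
  constructor _⇒_
  field
    src : ℕ
    tgt : ℕ
open Rule public

record ForcingNetwork (N : ℕ) : Set where
  field
    X        : List ℕ
    X-range  : All (λ x → 1 ≤ x × x ≤ N) X
    X-unique : Unique X
    R        : List Rule
    R-valid  : All (λ r → src r ∈ X × tgt r ∈ X × src r ≢ tgt r) R
open ForcingNetwork public

Coloring : Graph → Set
Coloring G = Fin (n G) → ℕ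

IsXColoring : ∀ {N} → ForcingNetwork N → (G : Graph) → Coloring G → Set
IsXColoring F G c = ∀ v → c v ∈ X F

forceStep : (G : Graph) → Rule → Coloring G → Coloring G
forceStep G (a ⇒ b) c v =
  if (c v ≡ᵇ b) ∧ any (λ w → adj G v w ∧ (c w ≡ᵇ a)) (allFin (n G))
  then a else c v

iterStep : (G : Graph) → Rule → ℕ → Coloring G → Coloring G
iterStep G r zero    c = c
iterStep G r (suc t) c = forceStep G r (iterStep G r t c)

Stable : (G : Graph) → Rule → Coloring G → Set
Stable G (a ⇒ b) c = ∀ v w → adj G v w ≡ true → c w ≡ a → c v ≢ b

Terminal : ∀ {N} → ForcingNetwork N → (G : Graph) → Coloring G → Set
Terminal F G c = ∀ r → r ∈ R F → Stable G r c

-- Reach F G c₀ c rs : in the multi-color forcing process with propagation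
-- started from c₀, the current coloring is c and the rules still to be
-- applied in the current round are rs (a suffix of R).  A propagating
-- forcing step with rule r performs t forcing steps, where after t steps
-- no further change is possible (Stable).
data Reach {N} (F : ForcingNetwork N) (G : Graph) (c₀ : Coloring G)
     : Coloring G → List Rule → Set where
  start : Reach F G c₀ c₀ (R F)
  wrap  : ∀ {c} → Reach F G c₀ c [] → Reach F G c₀ c (R F)
  prop  : ∀ {c r rs} t → Reach F G c₀ c (r ∷ rs) → ¬ Terminal F G c →
          Stable G r (iterStep G r t c) →
          Reach F G c₀ (iterStep G r t c) rs

-- A vertex that receives colour a in forcing step i has, by the definition of
-- a forcing step, a neighbour that received colour a in step i − 1 (or carried
-- it from the start).  Following these neighbours back from a vertex that is
-- still forced in step t + 1 yields a path of length t + 1, and its vertices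
-- are distinct because they received colour a at strictly decreasing times.
-- Hence a propagating step is over after t forcing steps as soon as every path
-- has length at most t.  In a tree a path is a shortest walk between its ends
-- (a shorter walk would close a cycle with it), so every path has length at
-- most the diameter.
module Submission where

open import Defs
open import Data.Nat using (ℕ; _≤_)
open import Data.List using (List; _∷_)
open import Data.Product using (_×_; ∃; ∃-syntax; _,_; proj₁; proj₂)
open import Relation.Nullary using (¬_; yes; no; contradiction)
open import Level using (Level; _⊔_; 0ℓ)
open import Data.Nat using (zero; suc; _<_; _≡ᵇ_; z≤n; s≤s)
open import Data.Nat.Properties
  using (≡ᵇ⇒≡; ≡⇒≡ᵇ; ≤-refl; ≤-trans; m<n⇒m<1+n; m≤n⇒m<n∨m≡n; 1+n≰n)
  renaming (_≟_ to _≟ℕ_)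
open import Data.Fin using (Fin)
open import Data.Fin.Properties using (_≟_)
open import Data.Bool using (Bool; true; false; T; _∧_; if_then_else_)
open import Data.Bool.Properties using (T?; T-∧; T-≡)
open import Data.Bool.ListAction using (any)
open import Data.List using ([]; _++_; length; allFin)
open import Data.List.Membership.Propositional using (_∈_; lose)
open import Data.List.Membership.Propositional.Properties using (∈-allFin)
open import Data.List.Membership.DecPropositional using (_∈?_)
open import Data.List.Relation.Unary.Any using (here; there; satisfied)
open import Data.List.Relation.Unary.Any.Properties using (any⁺; any⁻)
open import Data.List.Relation.Unary.All as All using (All; []; _∷_)
open import Data.List.Relation.Unary.All.Properties using (¬Any⇒All¬)
open import Data.List.Relation.Unary.Unique.Propositional using (Unique)
open import Data.List.Relation.Unary.AllPairs using ([]; _∷_)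
open import Data.Sum using (_⊎_; inj₁; inj₂)
open import Data.Unit using (⊤; tt)
open import Function using (Equivalence)
open Equivalence using (to; from)
open import Relation.Binary using (Rel; Symmetric; DecidableEquality)
open import Relation.Binary.PropositionalEquality
  using (_≡_; _≢_; refl; trans; cong; subst; ≢-sym)
import Relation.Binary.PropositionalEquality as ≡

private
  variable
    ℓ ℓ′ ℓ″ : Level

module _ {V : Set ℓ} where

  data ListWalk (E : Rel V ℓ′) : V → V → List V → Set (ℓ ⊔ ℓ′) where
    ε   : ∀ {v} → ListWalk E v v []
    _◅_ : ∀ {u v w vs} → E u v → ListWalk E v w vs → ListWalk E u w (v ∷ vs)

  infixr 5 _◅_

  module _ {E : Rel V ℓ′} where

    infixr 5 _◅◅_

    _◅◅_ : ∀ {u v w as bs} →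
           ListWalk E u v as → ListWalk E v w bs → ListWalk E u w (as ++ bs)
    ε       ◅◅ W′ = W′
    (e ◅ W) ◅◅ W′ = e ◅ (W ◅◅ W′)

    map : ∀ {E′ : Rel V ℓ″} → (∀ {s t} → E s t → E′ s t) →
          ∀ {u w vs} → ListWalk E u w vs → ListWalk E′ u w vs
    map f ε       = ε
    map f (e ◅ W) = f e ◅ map f W

    reverse : Symmetric E → ∀ {u w vs} → ListWalk E u w vs → ∃[ ws ] ListWalk E w u ws
    reverse E-sym ε       = [] , ε
    reverse E-sym (e ◅ W) with reverse E-sym W
    ... | _ , W′ = _ , W′ ◅◅ (E-sym e ◅ ε)

    ListWalk-last : ∀ {u w v vs} → ListWalk E u w (v ∷ vs) →
                    ∃[ init ] v ∷ vs ≡ init ++ w ∷ []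
    ListWalk-last (e ◅ ε) = [] , refl
    ListWalk-last {v = v} (e ◅ W@(_ ◅ _)) with ListWalk-last W
    ... | init , eq = v ∷ init , cong (v ∷_) eq

    dropTo : ∀ {z u w vs} → z ∈ u ∷ vs → ListWalk E u w vs → Unique (u ∷ vs) →
             ∃[ ws ] ListWalk E z w ws × Unique (z ∷ ws)
    dropTo (here refl)  W       U       = _ , W , U
    dropTo (there z∈vs) (e ◅ W) (_ ∷ U) = dropTo z∈vs W U

    shortcut : DecidableEquality V → ∀ {u w vs} → ListWalk E u w vs →
               ∃[ ws ] ListWalk E u w ws × Unique (u ∷ ws)
    shortcut _≟ᵥ_ ε = [] , ε , [] ∷ []
    shortcut _≟ᵥ_ {u} (e ◅ W) with shortcut _≟ᵥ_ W
    ... | ws , W′ , U with _∈?_ _≟ᵥ_ u (_ ∷ ws)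
    ...   | yes u∈ws = dropTo u∈ws W′ U
    ...   | no  u∉ws = _ , e ◅ W′ , ¬Any⇒All¬ _ u∉ws ∷ U

module _ (G : Graph) where

  private
    V = Fin (n G)

  Adj : Rel V 0ℓ
  Adj u v = adj G u v ≡ true

  Adj-sym : Symmetric Adj
  Adj-sym {u} {v} uv = trans (Graph.sym G v u) uv

  PathsBoundedBy : ℕ → Set
  PathsBoundedBy t = ∀ {u w ps} → ListWalk Adj u w ps → Unique (u ∷ ps) → length ps ≤ t

  AdjExcept : V → V → Rel V 0ℓ
  AdjExcept x y s t = Adj s t × ¬ (s ≡ x × t ≡ y) × ¬ (s ≡ y × t ≡ x)

  AdjExcept-sym : ∀ {x y} → Symmetric (AdjExcept x y)
  AdjExcept-sym (st , ¬xy , ¬yx) =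
    Adj-sym st ,
    (λ (t≡x , s≡y) → ¬yx (s≡y , t≡x)) ,
    (λ (t≡y , s≡x) → ¬xy (s≡x , t≡y))

  AdjExcept-swap : ∀ {x y s t} → AdjExcept x y s t → AdjExcept y x s t
  AdjExcept-swap (st , ¬xy , ¬yx) = st , ¬yx , ¬xy

  avoiding⇒except : ∀ {x y u w vs} → All (x ≢_) (u ∷ vs) →
                    ListWalk Adj u w vs → ListWalk (AdjExcept x y) u w vs
  avoiding⇒except _ ε = ε
  avoiding⇒except (x≢u ∷ x≢v ∷ avoid) (uv ◅ W) =
    (uv , (λ (u≡x , _) → x≢u (≡.sym u≡x)) , (λ (_ , v≡x) → x≢v (≡.sym v≡x)))
    ◅ avoiding⇒except (x≢v ∷ avoid) W

  ListWalk⇒Walk : ∀ {u w vs} → ListWalk Adj u w vs → Walk G u w (length vs)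
  ListWalk⇒Walk {u} ε  = here u
  ListWalk⇒Walk (uv ◅ W) = cons uv (ListWalk⇒Walk W)

  ListWalk⇒Chain : ∀ {u w vs} → ListWalk Adj u w vs → Chain G (u ∷ vs)
  ListWalk⇒Chain {u} ε  = one u
  ListWalk⇒Chain (uv ◅ W) = cons uv (ListWalk⇒Chain W)

  reaches-or-avoids : ∀ z {u w k} → Walk G u w k → z ≢ u →
                      (∃[ k′ ] k′ < k × Walk G z w k′) ⊎
                      (∃[ vs ] ListWalk Adj u w vs × All (z ≢_) (u ∷ vs))
  reaches-or-avoids z (here u) z≢u = inj₂ ([] , ε , z≢u ∷ [])
  reaches-or-avoids z (cons {v = v} uv W) z≢u with z ≟ v
  ... | yes refl = inj₁ (_ , ≤-refl , W)
  ... | no z≢v with reaches-or-avoids z W z≢v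
  ...   | inj₁ (k′ , k′<k , W′)  = inj₁ (k′ , m<n⇒m<1+n k′<k , W′)
  ...   | inj₂ (vs , W′ , avoid) = inj₂ (v ∷ vs , uv ◅ W′ , z≢u ∷ avoid)

  cycle : ∀ {x y ws} → Adj x y → ListWalk (AdjExcept x y) y x ws → Unique (y ∷ ws) →
          HasCycle G
  cycle {x} xx ε _ = contradiction (trans (≡.sym xx) (irrefl G x)) λ ()
  cycle xy ((_ , _ , ¬yx) ◅ ε) _ = contradiction (refl , refl) ¬yx
  cycle {x} {y} xy W@(_ ◅ _ ◅ _) U with ListWalk-last W
  ... | init , eq = y , init , x ,
    subst (λ l → 3 ≤ length (y ∷ l)) eq (s≤s (s≤s (s≤s z≤n))) ,
    subst (λ l → Unique (y ∷ l)) eq U ,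
    subst (λ l → Chain G (y ∷ l)) eq (ListWalk⇒Chain (map proj₁ W)) ,
    xy

module _ {G : Graph} (acyclic : ¬ HasCycle G) where

  -- A walk from u to w missing the second vertex q of the path, followed by
  -- the rest of the path back to q, joins u to q without the edge {u, q}.
  path-shortest : ∀ {u w ps k} → ListWalk (Adj G) u w ps → Unique (u ∷ ps) →
                  Walk G u w k → length ps ≤ k
  path-shortest ε _ _ = z≤n
  path-shortest (uq ◅ P) (u∉ps ∷ U) W with reaches-or-avoids G _ W (≢-sym (All.head u∉ps))
  ... | inj₁ (k′ , k′<k , W′) = ≤-trans (s≤s (path-shortest P U W′)) k′<k
  ... | inj₂ (_ , W′ , q∉W′)
    with reverse (AdjExcept-sym G) (map (AdjExcept-swap G) (avoiding⇒except G u∉ps P))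
  ...   | _ , P⁻¹ with shortcut _≟_ (avoiding⇒except G q∉W′ W′ ◅◅ P⁻¹)
  ...     | _ , C , U′ = contradiction (cycle G (Adj-sym G uq) C U′) acyclic

  path⇒Dist : ∀ {u w ps} → ListWalk (Adj G) u w ps → Unique (u ∷ ps) →
              Dist G u w (length ps)
  path⇒Dist P U = ListWalk⇒Walk G P , λ _ W → path-shortest P U W

  diam⇒PathsBoundedBy : ∀ {D} → IsDiam G D → PathsBoundedBy G D
  diam⇒PathsBoundedBy (_ , maximal) P U = maximal _ _ _ (path⇒Dist P U)

module _ (G : Graph) {a b : ℕ} where

  private
    if-T : ∀ {A : Set} {x} {p q : A} → T x → (if x then p else q) ≡ p
    if-T {x = true} _ = refl

    if-¬T : ∀ {A : Set} {x} {p q : A} → ¬ T x → (if x then p else q) ≡ q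
    if-¬T {x = true}  ¬t = contradiction _ ¬t
    if-¬T {x = false} _  = refl

    hasANeighbour : Coloring G → Fin (n G) → Bool
    hasANeighbour c v = any (λ w → adj G v w ∧ (c w ≡ᵇ a)) (allFin (n G))

  forceStep-unchanged : ∀ c v → c v ≢ b → forceStep G (a ⇒ b) c v ≡ c v
  forceStep-unchanged c v cv≢b =
    if-¬T (λ cond → cv≢b (≡ᵇ⇒≡ (c v) b (proj₁ (to T-∧ cond))))

  forceStep-forces : ∀ c v w → c v ≡ b → Adj G v w → c w ≡ a →
                     forceStep G (a ⇒ b) c v ≡ a
  forceStep-forces c v w cv≡b vw cw≡a =
    if-T (from T-∧ (≡⇒≡ᵇ (c v) b cv≡b , any⁺ _ (lose (∈-allFin w) w-coloured-a)))
    where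
    w-coloured-a : T (adj G v w ∧ (c w ≡ᵇ a))
    w-coloured-a = from T-∧ (from T-≡ vw , ≡⇒≡ᵇ (c w) a cw≡a)

  forceStep-witness : ∀ c v → forceStep G (a ⇒ b) c v ≢ c v →
                      ∃[ w ] Adj G v w × c w ≡ a
  forceStep-witness c v changed with T? ((c v ≡ᵇ b) ∧ hasANeighbour c v)
  ... | no ¬cond = contradiction (if-¬T ¬cond) changed
  ... | yes cond with satisfied (any⁻ _ (allFin (n G)) (proj₂ (to (T-∧ {c v ≡ᵇ b}) cond)))
  ...   | w , vw∧cw≡a with to T-∧ vw∧cw≡a
  ...     | vw , cw≡a = w , to T-≡ vw , ≡ᵇ⇒≡ (c w) a cw≡a

module Propagation (G : Graph) {a b : ℕ} (a≢b : a ≢ b) (c : Coloring G) where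

  private
    V = Fin (n G)

  after : ℕ → Coloring G
  after t = iterStep G (a ⇒ b) t c

  a-persists : ∀ {i j x} → i ≤ j → after i x ≡ a → after j x ≡ a
  a-persists {j = zero} z≤n xa = xa
  a-persists {j = suc j} {x} i≤1+j xa with m≤n⇒m<n∨m≡n i≤1+j
  ... | inj₁ (s≤s i≤j) =
    trans (forceStep-unchanged G (after j) x (λ xb → a≢b (trans (≡.sym xa′) xb))) xa′
    where
    xa′ : after j x ≡ a
    xa′ = a-persists i≤j xa
  ... | inj₂ refl = xa

  b-earlier : ∀ {j x} → after (suc j) x ≡ b → after j x ≡ b
  b-earlier {j} {x} xb with after j x ≟ℕ b
  ... | yes xb′ = xb′
  ... | no  x≢b =
    contradiction (trans (≡.sym (forceStep-unchanged G (after j) x x≢b)) xb) x≢b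

  -- Time 0 stands for the vertices coloured a from the start.
  WasBBefore : ℕ → V → Set
  WasBBefore zero    _ = ⊤
  WasBBefore (suc i) x = after i x ≡ b

  BecomesA : V → ℕ → Set
  BecomesA x i = after i x ≡ a × WasBBefore i x

  BecomesA-≢ : ∀ {x z i k} → BecomesA x i → BecomesA z k → k < i → x ≢ z
  BecomesA-≢ {i = suc i} (_ , xb) (za , _) (s≤s k≤i) refl =
    a≢b (trans (≡.sym (a-persists k≤i za)) xb)

  -- Had y been coloured a one step earlier, it would have forced x.
  a-neighbour-WasBBefore : ∀ {j x y} → after j x ≡ b → Adj G x y → after j y ≡ a →
                           WasBBefore j y
  a-neighbour-WasBBefore {zero}          _  _  _  = tt
  a-neighbour-WasBBefore {suc j} {x} {y} xb xy ya with after j y ≟ℕ b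
  ... | yes yb  = yb
  ... | no  y≢b = contradiction (forceStep-forces G (after j) x y (b-earlier {j} xb) xy ya′) b≢a
    where
    ya′ : after j y ≡ a
    ya′ = trans (≡.sym (forceStep-unchanged G (after j) y y≢b)) ya
    b≢a : after (suc j) x ≢ a
    b≢a xa = a≢b (trans (≡.sym xa) xb)

  BecomesA-predecessor : ∀ {x j} → BecomesA x (suc j) → ∃[ y ] Adj G x y × BecomesA y j
  BecomesA-predecessor {x} {j} (xa , xb)
    with forceStep-witness G (after j) x (λ eq → a≢b (trans (≡.sym xa) (trans eq xb)))
  ... | y , xy , ya = y , xy , ya , a-neighbour-WasBBefore xb xy ya

  forcingPath : ∀ {x i} → BecomesA x i →
                ∃[ x₀ ] ∃[ ps ] ListWalk (Adj G) x x₀ ps × length ps ≡ i ×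
                  All (λ z → ∃[ k ] k < i × BecomesA z k) ps × Unique (x ∷ ps)
  forcingPath {i = zero} _ = _ , [] , ε , refl , [] , [] ∷ []
  forcingPath {x} {suc j} x↑ with BecomesA-predecessor x↑
  ... | y , xy , y↑ with forcingPath y↑
  ...   | x₀ , ps , P , len , earlier , U =
    x₀ , y ∷ ps , xy ◅ P , cong suc len , earlier′ ,
    All.map (λ (_ , k<i , z↑) → BecomesA-≢ x↑ z↑ k<i) earlier′ ∷ U
    where
    earlier′ : All (λ z → ∃[ k ] k < suc j × BecomesA z k) (y ∷ ps)
    earlier′ = (j , ≤-refl , y↑) ∷ All.map (λ (k , k<j , z↑) → k , m<n⇒m<1+n k<j , z↑) earlier

  stable-after : ∀ {t} → PathsBoundedBy G t → Stable G (a ⇒ b) (after t)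
  stable-after {t} bounded v w vw wa vb
    with forcingPath (forceStep-forces G (after t) v w vb vw wa , vb)
  ... | _ , _ , P , len , _ , U = 1+n≰n (subst (_≤ t) len (bounded P U))

Reach-pending⊆R : ∀ {N} {F : ForcingNetwork N} {G c₀ c rs r} →
                  Reach F G c₀ c rs → r ∈ rs → r ∈ R F
Reach-pending⊆R start           r∈rs = r∈rs
Reach-pending⊆R (wrap _)        r∈rs = r∈rs
Reach-pending⊆R (prop _ rch _ _) r∈rs = Reach-pending⊆R rch (there r∈rs)

theorem3p4 : ∀ {N} (F : ForcingNetwork N) (T : Graph) → IsTree T →
    ∀ D → IsDiam T D →
    ∀ (c₀ : Coloring T) → IsXColoring F T c₀ →
    ∀ c r rs → Reach F T c₀ c (r ∷ rs) → ¬ Terminal F T c →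
    ∃[ t ] (t ≤ D × Stable T r (iterStep T r t c))
theorem3p4 F T (_ , acyclic) D diam _ _ c (a ⇒ b) _ rch _ =
  D , ≤-refl , Propagation.stable-after T a≢b c (diam⇒PathsBoundedBy acyclic diam)
  where
  a≢b : a ≢ b
  a≢b = proj₂ (proj₂ (All.lookup (R-valid F) (Reach-pending⊆R rch (here refl))))
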